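{- Let $X=\{x,y,z\}$, $N=\{1,\dots,n\}$ with $n\ge 3$, and let $g:NP\to X$ be strategy-proof. Define the profiles (individuals $3,\dots,n-2$, if any, have $y\succ z\succ x$ in both): $L2^{**}$: individual $1$ has $y\succ z\succ x$, individual $2$ has $z\succ x\succ y$, individual $n-1$ has $x\succ z\succ y$, individual $n$ has $z\succ x\succ y$; $L3^{**}$: individual $1$ has $z\succ y\succ x$, individual $2$ has $z\succ x\succ y$, individual $n-1$ has $x\succ y\succ z$, individual $n$ has $z\succ x\succ y$. Then $g(L3^{**})=x$ implies $g(L2^{**})=x$.
   Context: A profile is a map $p:N\to L(X)$, where $L(X)$ is the set of strict linear orderings of $X$; write $a\succ_{p(i)}b$ if individual $i$ strictly prefers $a$ to $b$ at $p$. $NP$ is the set of all profiles $p$ such that for every pair of distinct alternatives $a,b$ there exist individuals $i,j$ with $a\succ_{p(i)}b$ and $b\succ_{p(j)}a$. Two profiles $p,q$ are $h$-variants if $q(i)=p(i)$ for all $i\neq h$. A rule $g:NP\to X$ is strategy-proof if there are no $h\in N$ and $h$-variants $p,p'\in NP$ with $g(p')\succ_{p(h)}g(p)$. -}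

module Defs where

open import Data.Nat using (ℕ; _<_; _≤_; _+_; _∸_)
open import Data.Fin using (Fin; toℕ)
open import Data.Product using (_×_; Σ; ∃; ∃-syntax; _,_)
open import Relation.Binary.PropositionalEquality using (_≡_; _≢_)
open import Relation.Nullary using (¬_)

data Alt : Set where
  x y z : Alt

-- L(X): the six strict linear orderings of X, named by listing the
-- alternatives from best to worst (e.g. yzx means y ≻ z ≻ x).
data Order : Set where
  xyz xzy yxz yzx zxy zyx : Order

-- Position of an alternative in an ordering (0 = best).
rank : Order → Alt → ℕ
rank xyz x = 0
rank xyz y = 1
rank xyz z = 2
rank xzy x = 0
rank xzy z = 1
rank xzy y = 2
rank yxz y = 0
rank yxz x = 1
rank yxz z = 2
rank yzx y = 0
rank yzx z = 1
rank yzx x = 2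
rank zxy z = 0
rank zxy x = 1
rank zxy y = 2
rank zyx z = 0
rank zyx y = 1
rank zyx x = 2

_≻⟨_⟩_ : Alt → Order → Alt → Set
a ≻⟨ o ⟩ b = rank o a < rank o b

-- Individuals N = {1,…,n} are represented by Fin n; individual k is the
-- element with toℕ = k - 1.
Profile : ℕ → Set
Profile n = Fin n → Order

NP : ∀ {n} → Profile n → Set
NP {n} p = ∀ (a b : Alt) → a ≢ b →
  ∃[ i ] ∃[ j ] (a ≻⟨ p i ⟩ b × b ≻⟨ p j ⟩ a)

Variant : ∀ {n} → Fin n → Profile n → Profile n → Set
Variant h p q = ∀ i → i ≢ h → q i ≡ p i

-- A rule g : NP → X is represented by a function on all profiles, of which
-- only the values on NP matter.  Strategy-proofness as in the paper.
StrategyProof : ∀ {n} → (Profile n → Alt) → Set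
StrategyProof {n} g = ∀ (h : Fin n) (p p' : Profile n) → Variant h p p' →
  NP p → NP p' → ¬ (g p' ≻⟨ p h ⟩ g p)

IsL2** : ∀ {n} → Profile n → Set
IsL2** {n} p = ∀ (i : Fin n) →
  (toℕ i ≡ 0 → p i ≡ yzx) ×
  (toℕ i ≡ 1 → p i ≡ zxy) ×
  (toℕ i ≡ n ∸ 2 → p i ≡ xzy) ×
  (toℕ i ≡ n ∸ 1 → p i ≡ zxy) ×
  (2 ≤ toℕ i → toℕ i + 3 ≤ n → p i ≡ yzx)

IsL3** : ∀ {n} → Profile n → Set
IsL3** {n} p = ∀ (i : Fin n) →
  (toℕ i ≡ 0 → p i ≡ zyx) ×
  (toℕ i ≡ 1 → p i ≡ zxy) ×
  (toℕ i ≡ n ∸ 2 → p i ≡ xyz) ×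
  (toℕ i ≡ n ∸ 1 → p i ≡ zxy) ×
  (2 ≤ toℕ i → toℕ i + 3 ≤ n → p i ≡ yzx)

module Submission where

-- Let M be the profile L3** in which individual 1 reports
-- y≻z≻x (her order in L2**) instead of z≻y≻x.  Two unilateral deviations
-- connect L3** to L2**, and each can only preserve the outcome x:
--   * L3** → M (individual 1).  Alternative x is individual 1's worst at
--     L3**, so if g(M) ≠ x she gains by misreporting; hence g(M) = x.
--   * L2** → M (individual n-1).  Her order at L2** is x≻z≻y and M differs
--     from L2** only in her order; x is her best, so if g(L2**) ≠ x she
--     gains by reporting x≻y≻z; hence g(L2**) = x.
-- Both deviations must stay inside NP; this holds because M contains the
-- Condorcet cycle y≻z≻x, z≻x≻y, x≻y≻z.

open import Defs
open import Data.Nat using (ℕ; zero; suc; _<_; _≤_; _+_; _∸_; z≤n; s≤s; s≤s⁻¹) renaming (_≟_ to _≟ℕ_)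
open import Data.Nat.Properties using (≤∧≢⇒<; 1+n≢0; +-comm; n<1+n; m<n⇒m<1+n)
open import Data.Fin using (Fin; toℕ; fromℕ<) renaming (zero to fzero; suc to fsuc)
open import Data.Fin.Properties using (toℕ<n; toℕ-fromℕ<; toℕ-injective) renaming (_≟_ to _≟ᶠ_)
open import Data.Vec.Functional using (updateAt)
open import Data.Vec.Functional.Properties using (updateAt-minimal)
open import Data.Product using (_×_; _,_)
open import Data.Sum using (_⊎_; inj₁; inj₂)
open import Data.Empty using (⊥-elim)
open import Function using (const; _∘_)
open import Relation.Nullary using (¬_; Dec; yes; no)
open import Relation.Binary.PropositionalEquality using (_≡_; _≢_; refl; sym; trans; cong; subst)

_≟ᴬ_ : (a b : Alt) → Dec (a ≡ b)
x ≟ᴬ x = yes refl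
x ≟ᴬ y = no λ ()
x ≟ᴬ z = no λ ()
y ≟ᴬ x = no λ ()
y ≟ᴬ y = yes refl
y ≟ᴬ z = no λ ()
z ≟ᴬ x = no λ ()
z ≟ᴬ y = no λ ()
z ≟ᴬ z = yes refl

best worst : Order → Alt
best xyz = x
best xzy = x
best yxz = y
best yzx = y
best zxy = z
best zyx = z
worst xyz = z
worst xzy = y
worst yxz = z
worst yzx = x
worst zxy = y
worst zyx = x

best-beats : ∀ o a → a ≢ best o → best o ≻⟨ o ⟩ a
best-beats xyz x a≢ = ⊥-elim (a≢ refl)
best-beats xyz y _ = s≤s z≤n
best-beats xyz z _ = s≤s z≤n
best-beats xzy x a≢ = ⊥-elim (a≢ refl)
best-beats xzy y _ = s≤s z≤n
best-beats xzy z _ = s≤s z≤n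
best-beats yxz x _ = s≤s z≤n
best-beats yxz y a≢ = ⊥-elim (a≢ refl)
best-beats yxz z _ = s≤s z≤n
best-beats yzx x _ = s≤s z≤n
best-beats yzx y a≢ = ⊥-elim (a≢ refl)
best-beats yzx z _ = s≤s z≤n
best-beats zxy x _ = s≤s z≤n
best-beats zxy y _ = s≤s z≤n
best-beats zxy z a≢ = ⊥-elim (a≢ refl)
best-beats zyx x _ = s≤s z≤n
best-beats zyx y _ = s≤s z≤n
best-beats zyx z a≢ = ⊥-elim (a≢ refl)

beats-worst : ∀ o a → a ≢ worst o → a ≻⟨ o ⟩ worst o
beats-worst xyz x _ = s≤s z≤n
beats-worst xyz y _ = s≤s (s≤s z≤n)
beats-worst xyz z a≢ = ⊥-elim (a≢ refl)
beats-worst xzy x _ = s≤s z≤n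
beats-worst xzy y a≢ = ⊥-elim (a≢ refl)
beats-worst xzy z _ = s≤s (s≤s z≤n)
beats-worst yxz x _ = s≤s (s≤s z≤n)
beats-worst yxz y _ = s≤s z≤n
beats-worst yxz z a≢ = ⊥-elim (a≢ refl)
beats-worst yzx x a≢ = ⊥-elim (a≢ refl)
beats-worst yzx y _ = s≤s z≤n
beats-worst yzx z _ = s≤s (s≤s z≤n)
beats-worst zxy x _ = s≤s (s≤s z≤n)
beats-worst zxy y a≢ = ⊥-elim (a≢ refl)
beats-worst zxy z _ = s≤s z≤n
beats-worst zyx x a≢ = ⊥-elim (a≢ refl)
beats-worst zyx y _ = s≤s (s≤s z≤n)
beats-worst zyx z _ = s≤s z≤n

unbeaten-by-best : ∀ o a → ¬ (best o ≻⟨ o ⟩ a) → a ≡ best o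
unbeaten-by-best o a ¬≻ with a ≟ᴬ best o
... | yes a≡best = a≡best
... | no a≢best = ⊥-elim (¬≻ (best-beats o a a≢best))

not-beating-worst : ∀ o a → ¬ (a ≻⟨ o ⟩ worst o) → a ≡ worst o
not-beating-worst o a ¬≻ with a ≟ᴬ worst o
... | yes a≡worst = a≡worst
... | no a≢worst = ⊥-elim (¬≻ (beats-worst o a a≢worst))

module _ {n : ℕ} {g : Profile n → Alt} (sp : StrategyProof g)
         {h : Fin n} {p p' : Profile n} (var : Variant h p p')
         (np : NP p) (np' : NP p') where

  -- If g selects h's worst alternative at p, a deviation of h cannot move
  -- the outcome: anything else would be an improvement for h.
  worst-is-kept : ∀ {o} → p h ≡ o → g p ≡ worst o → g p' ≡ worst o
  worst-is-kept refl gp≡worst =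
    not-beating-worst (p h) (g p')
      (subst (λ b → ¬ (g p' ≻⟨ p h ⟩ b)) gp≡worst (sp h p p' var np np'))

  -- If a deviation of h yields h's best alternative at p, then g already
  -- selects it at p, for otherwise h would deviate.
  best-is-reached : ∀ {o} → p h ≡ o → g p' ≡ best o → g p ≡ best o
  best-is-reached refl gp'≡best =
    unbeaten-by-best (p h) (g p)
      (subst (λ a → ¬ (a ≻⟨ p h ⟩ g p)) gp'≡best (sp h p p' var np np'))

condorcet-NP : ∀ {n} (p : Profile n) (i j k : Fin n) →
  p i ≡ yzx → p j ≡ zxy → p k ≡ xyz → NP p
condorcet-NP {n} p i j k pi≡ pj≡ pk≡ = split
  where
  at : ∀ {a b} (l : Fin n) {o} → p l ≡ o → a ≻⟨ o ⟩ b → a ≻⟨ p l ⟩ b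
  at l pl≡o = subst (λ o′ → _ ≻⟨ o′ ⟩ _) (sym pl≡o)

  split : NP p
  split x x x≢x = ⊥-elim (x≢x refl)
  split y y y≢y = ⊥-elim (y≢y refl)
  split z z z≢z = ⊥-elim (z≢z refl)
  split x y _ = k , i , at k pk≡ (best-beats xyz y λ ()) , at i pi≡ (beats-worst yzx y λ ())
  split y x _ = i , k , at i pi≡ (beats-worst yzx y λ ()) , at k pk≡ (best-beats xyz y λ ())
  split x z _ = k , j , at k pk≡ (beats-worst xyz x λ ()) , at j pj≡ (best-beats zxy x λ ())
  split z x _ = j , k , at j pj≡ (best-beats zxy x λ ()) , at k pk≡ (beats-worst xyz x λ ())
  split y z _ = i , j , at i pi≡ (best-beats yzx z λ ()) , at j pj≡ (best-beats zxy y λ ())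
  split z y _ = j , i , at j pj≡ (best-beats zxy y λ ()) , at i pi≡ (best-beats yzx z λ ())

updateAt-variant : ∀ {n} (p : Profile n) (h : Fin n) (o : Order) →
  Variant h p (updateAt p h (const o))
updateAt-variant p h o i i≢h = updateAt-minimal i h p i≢h

clear-of-last-two : ∀ {t n} → t < n → t ≢ n ∸ 1 → t ≢ n ∸ 2 → t + 3 ≤ n
clear-of-last-two {t} {suc zero} (s≤s z≤n) t≢0 _ = ⊥-elim (t≢0 refl)
clear-of-last-two {t} {suc (suc k)} (s≤s t≤1+k) t≢1+k t≢k
  rewrite +-comm t 3 = s≤s (s≤s (≤∧≢⇒< (s≤s⁻¹ (≤∧≢⇒< t≤1+k t≢1+k)) t≢k))

other-individuals : ∀ {t n} → t < n → t ≢ 0 → t ≢ n ∸ 2 →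
  t ≡ 1 ⊎ t ≡ n ∸ 1 ⊎ (2 ≤ t × t + 3 ≤ n)
other-individuals {zero} _ t≢0 _ = ⊥-elim (t≢0 refl)
other-individuals {suc zero} _ _ _ = inj₁ refl
other-individuals {suc (suc u)} {n} t<n _ t≢n-2 with suc (suc u) ≟ℕ n ∸ 1
... | yes t≡n-1 = inj₂ (inj₁ t≡n-1)
... | no t≢n-1 = inj₂ (inj₂ (s≤s (s≤s z≤n) , clear-of-last-two t<n t≢n-1 t≢n-2))

L2-L3-agree : ∀ {n} {L2 L3 : Profile n} → IsL2** L2 → IsL3** L3 →
  ∀ i → toℕ i ≢ 0 → toℕ i ≢ n ∸ 2 → L2 i ≡ L3 i
L2-L3-agree isL2 isL3 i i≢0 i≢n-2
  with isL2 i | isL3 i | other-individuals (toℕ<n i) i≢0 i≢n-2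
... | _ , second₂ , _ , _ , _ | _ , second₃ , _ , _ , _ | inj₁ e =
  trans (second₂ e) (sym (second₃ e))
... | _ , _ , _ , last₂ , _ | _ , _ , _ , last₃ , _ | inj₂ (inj₁ e) =
  trans (last₂ e) (sym (last₃ e))
... | _ , _ , _ , _ , middle₂ | _ , _ , _ , _ , middle₃ | inj₂ (inj₂ (2≤t , t+3≤n)) =
  trans (middle₂ 2≤t t+3≤n) (sym (middle₃ 2≤t t+3≤n))

mainTheorem8 : (n : ℕ) → 3 ≤ n → (g : Profile n → Alt) → StrategyProof g →
    (L2 L3 : Profile n) → IsL2** L2 → IsL3** L3 → NP L2 → NP L3 →
    g L3 ≡ x → g L2 ≡ x
mainTheorem8 (suc (suc (suc m))) (s≤s (s≤s (s≤s _))) g sp L2 L3 isL2 isL3 npL2 npL3 gL3≡x =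
  best-is-reached sp L2∼M npL2 npM L2[n-1] gM≡x
  where
  -- Individual n-1, whose order is x≻z≻y in L2** and x≻y≻z in L3**.
  h : Fin (suc (suc (suc m)))
  h = fromℕ< (m<n⇒m<1+n (n<1+n (suc m)))

  h≡n-2 : toℕ h ≡ suc m
  h≡n-2 = toℕ-fromℕ< (m<n⇒m<1+n (n<1+n (suc m)))

  h≢1 : h ≢ fzero
  h≢1 h≡0 = 1+n≢0 (trans (sym h≡n-2) (cong toℕ h≡0))

  L2[1] : L2 fzero ≡ yzx
  L2[1] = let (first , _) = isL2 fzero in first refl

  L3[1] : L3 fzero ≡ zyx
  L3[1] = let (first , _) = isL3 fzero in first refl

  L2[n-1] : L2 h ≡ xzy
  L2[n-1] = let (_ , _ , penult , _) = isL2 h in penult h≡n-2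

  M : Profile (suc (suc (suc m)))
  M = updateAt L3 fzero (const yzx)

  npM : NP M
  npM = condorcet-NP M fzero (fsuc fzero) h refl M[2] M[n-1]
    where
    M[2] : M (fsuc fzero) ≡ zxy
    M[2] = let (_ , second , _) = isL3 (fsuc fzero) in second refl
    M[n-1] : M h ≡ xyz
    M[n-1] = let (_ , _ , penult , _) = isL3 h in
             trans (updateAt-minimal h fzero {const yzx} L3 h≢1) (penult h≡n-2)

  gM≡x : g M ≡ x
  gM≡x = worst-is-kept sp (updateAt-variant L3 fzero yzx) npL3 npM L3[1] gL3≡x

  L2∼M : Variant h L2 M
  L2∼M i i≢h with i ≟ᶠ fzero
  ... | yes refl = sym L2[1]
  ... | no i≢1 = trans (updateAt-minimal i fzero {const yzx} L3 i≢1)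
    (sym (L2-L3-agree isL2 isL3 i (i≢1 ∘ toℕ-injective {j = fzero})
                                  (i≢h ∘ toℕ-injective ∘ λ e → trans e (sym h≡n-2))))
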